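{- Let $D$ be a skew Young diagram and let $M$ be a maximal (with respect to inclusion) independent set of the downcore graph of $D$. Then for every row $y$ that contains at least one box of $D$, $M$ contains at least one box in row $y$.
   Context: Boxes are indexed by pairs $(x,y)$ of positive integers, $x$ the column (from the left) and $y$ the row (from the bottom). A Young diagram is a finite set $\lambda$ of boxes such that if $(k,\ell)\in\lambda$ then every $(k',\ell')$ with $1\le k'\le k$, $1\le \ell'\le\ell$ is in $\lambda$. A skew Young diagram is a set $D=\lambda\setminus\mu$ where $\mu\subseteq\lambda$ are Young diagrams. The downcore graph of $D$ has vertex set $D$, with an edge between $(i,j)$ and $(k,\ell)$ if and only if ($i<k$ and $j>\ell$, or $i>k$ and $j<\ell$) and both $(i,\ell)$ and $(k,j)$ belong to $D$. -}

module Defs where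

open import Data.Nat using (ℕ; _≤_; _<_)
open import Data.Bool using (Bool; true; false)
open import Data.Product using (_×_; Σ; ∃; ∃-syntax)
open import Data.Sum using (_⊎_)
open import Relation.Binary.PropositionalEquality using (_≡_)

-- A set of boxes is given by its (Boolean) membership function:
-- S x y ≡ true  means the box (x , y) (column x, row y) is in S.
BoxSet : Set
BoxSet = ℕ → ℕ → Bool

_⊆B_ : BoxSet → BoxSet → Set
S ⊆B T = ∀ x y → S x y ≡ true → T x y ≡ true

record YoungDiagram : Set where
  field
    mem      : BoxSet
    positive : ∀ x y → mem x y ≡ true → 1 ≤ x × 1 ≤ y
    finite   : ∃[ N ] (∀ x y → mem x y ≡ true → x ≤ N × y ≤ N)
    closed   : ∀ k l k′ l′ → mem k l ≡ true → 1 ≤ k′ → k′ ≤ k →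
               1 ≤ l′ → l′ ≤ l → mem k′ l′ ≡ true
open YoungDiagram public

skew : BoxSet → BoxSet → BoxSet
skew l m x y with l x y | m x y
... | true | false = true
... | _    | _     = false

record SkewDiagram : Set where
  field
    outer : YoungDiagram
    inner : YoungDiagram
    inner⊆outer : mem inner ⊆B mem outer
  boxes : BoxSet
  boxes = skew (mem outer) (mem inner)
open SkewDiagram public

DowncoreEdge : BoxSet → ℕ → ℕ → ℕ → ℕ → Set
DowncoreEdge D i j k l =
  ((i < k × l < j) ⊎ (k < i × j < l)) × D i l ≡ true × D k j ≡ true

IsIndependent : BoxSet → BoxSet → Set
IsIndependent D M =
  M ⊆B D ×
  (∀ i j k l → M i j ≡ true → M k l ≡ true → DowncoreEdge D i j k l → Data.Empty.⊥)
  where import Data.Empty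

IsMaximalIndependent : BoxSet → BoxSet → Set
IsMaximalIndependent D M =
  IsIndependent D M × (∀ M′ → IsIndependent D M′ → M ⊆B M′ → M′ ⊆B M)

module Submission where

-- Let M be a maximal independent set of the downcore graph
-- of a skew diagram D and suppose, for a contradiction, that row y is
-- occupied in D but empty in M.
--   * A maximal independent set is dominating: a box of D with no
--     neighbour in M is itself in M.  So every box (x , y) of row y has a
--     neighbour (a , l) in M, which lies either to the lower right
--     (x < a, l < y) or to the upper left (a < x, y < l).
--   * Rows of a skew diagram are intervals.  Using this and independence,
--     a lower-right neighbour of an upper-left neighbour's column is a
--     lower-right neighbour of (x , y) itself; by strong induction on x,
--     every box of row y has a lower-right neighbour in M.
--   * Such a neighbour (a , l) has (a , y) in D with a > x, so row y
--     would contain boxes arbitrarily far right, contradicting finiteness.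
-- Since M ⊆ D is bounded, "row y meets M" is decidable, so the
-- contradiction yields an explicit box of M in row y.

open import Defs
open import Data.Nat using (ℕ; zero; suc; _≤_; _<_; _≟_; _<?_; z≤n; s≤s)
open import Data.Nat.Properties using (≤-refl; ≤-trans; <-trans; <⇒≤; ≮⇒≥; <-irrefl)
open import Data.Nat.Induction using (<-rec)
open import Data.Bool using (true; false)
import Data.Bool as Bool
open import Data.Bool.Properties using (¬-not)
open import Data.Fin using (Fin; toℕ; fromℕ<)
open import Data.Fin.Properties using (any?; toℕ-fromℕ<)
open import Data.Product using (∃-syntax; Σ; _×_; _,_; proj₁; proj₂)
open import Data.Sum using (inj₁; inj₂; _⊎_)
open import Data.Empty using (⊥; ⊥-elim)
open import Function using (_∘_)
open import Relation.Nullary using (¬_; Dec; yes; no)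
open import Relation.Binary.PropositionalEquality using (_≡_; refl; sym; trans; subst)

skew-elim : ∀ l m x y → skew l m x y ≡ true → l x y ≡ true × m x y ≡ false
skew-elim l m x y with l x y | m x y
... | true  | false = λ _ → refl , refl
... | true  | true  = λ ()
... | false | _     = λ ()

skew-intro : ∀ l m x y → l x y ≡ true → m x y ≡ false → skew l m x y ≡ true
skew-intro l m x y lxy mxy rewrite lxy | mxy = refl

columns-bounded : (D : SkewDiagram) → ∃[ N ] (∀ x y → boxes D x y ≡ true → x ≤ N)
columns-bounded D with finite (outer D)
... | N , fin = N , λ x y b →
  proj₁ (fin x y (proj₁ (skew-elim (mem (outer D)) (mem (inner D)) x y b)))

-- Rows of a skew diagram are intervals: the outer shape is closed to the
-- left, and a box of the inner shape at c would force one at p ≤ c.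
row-convex : (D : SkewDiagram) → ∀ {p q c r} →
  boxes D p r ≡ true → boxes D q r ≡ true → p ≤ c → c ≤ q → boxes D c r ≡ true
row-convex D {p} {q} {c} {r} Dpr Dqr p≤c c≤q = skew-intro λD μD c r λc μc
  where
  λD μD : BoxSet
  λD = mem (outer D)
  μD = mem (inner D)
  p-pos : 1 ≤ p × 1 ≤ r
  p-pos = positive (outer D) p r (proj₁ (skew-elim λD μD p r Dpr))
  λc : λD c r ≡ true
  λc = closed (outer D) q r c r (proj₁ (skew-elim λD μD q r Dqr))
         (≤-trans (proj₁ p-pos) p≤c) c≤q (proj₂ p-pos) ≤-refl
  μc : μD c r ≡ false
  μc = ¬-not λ μc≡true → false≢true (trans (sym (proj₂ (skew-elim λD μD p r Dpr)))
         (closed (inner D) c r p r μc≡true (proj₁ p-pos) p≤c (proj₂ p-pos) ≤-refl))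
    where
    false≢true : false ≡ true → ⊥
    false≢true ()

edge-sym : ∀ {B i j k l} → DowncoreEdge B i j k l → DowncoreEdge B k l i j
edge-sym (inj₁ i<k×l<j , Bil , Bkj) = inj₂ i<k×l<j , Bkj , Bil
edge-sym (inj₂ k<i×j<l , Bil , Bkj) = inj₁ k<i×j<l , Bkj , Bil

edge-irrefl : ∀ {B i j} → ¬ DowncoreEdge B i j i j
edge-irrefl (inj₁ (i<i , _) , _) = <-irrefl refl i<i
edge-irrefl (inj₂ (i<i , _) , _) = <-irrefl refl i<i

insert : ℕ → ℕ → BoxSet → BoxSet
insert x y M a b with a ≟ x | b ≟ y
... | yes _ | yes _ = true
... | _     | _     = M a b

insert-cases : ∀ x y M a b → insert x y M a b ≡ true → (a ≡ x × b ≡ y) ⊎ M a b ≡ true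
insert-cases x y M a b h with a ≟ x | b ≟ y
... | yes a≡x | yes b≡y = inj₁ (a≡x , b≡y)
... | yes _   | no _    = inj₂ h
... | no _    | _       = inj₂ h

insert-self : ∀ {x y M} → insert x y M x y ≡ true
insert-self {x} {y} with x ≟ x | y ≟ y
... | yes _ | yes _ = refl
... | no x≢x | _     = ⊥-elim (x≢x refl)
... | yes _ | no y≢y = ⊥-elim (y≢y refl)

⊆-insert : ∀ {x y M} → M ⊆B insert x y M
⊆-insert {x} {y} a b Mab with a ≟ x | b ≟ y
... | yes _ | yes _ = refl
... | yes _ | no _  = Mab
... | no _  | _     = Mab

insert-independent : ∀ {B M x y} → IsIndependent B M → B x y ≡ true →
  (∀ k l → M k l ≡ true → ¬ DowncoreEdge B x y k l) → IsIndependent B (insert x y M)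
insert-independent {B} {M} {x} {y} (M⊆B , indep) Bxy lonely = subset , no-edge
  where
  subset : insert x y M ⊆B B
  subset a b h with insert-cases x y M a b h
  ... | inj₁ (refl , refl) = Bxy
  ... | inj₂ Mab = M⊆B a b Mab

  no-edge : ∀ i j k l → insert x y M i j ≡ true → insert x y M k l ≡ true →
            DowncoreEdge B i j k l → ⊥
  no-edge i j k l h₁ h₂ e with insert-cases x y M i j h₁ | insert-cases x y M k l h₂
  ... | inj₁ (refl , refl) | inj₁ (refl , refl) = edge-irrefl {B} e
  ... | inj₁ (refl , refl) | inj₂ Mkl = lonely k l Mkl e
  ... | inj₂ Mij | inj₁ (refl , refl) = lonely i j Mij (edge-sym {B} e)
  ... | inj₂ Mij | inj₂ Mkl = indep i j k l Mij Mkl e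

maximal⇒dominating : ∀ {B M x y} → IsMaximalIndependent B M → B x y ≡ true →
  (∀ k l → M k l ≡ true → ¬ DowncoreEdge B x y k l) → M x y ≡ true
maximal⇒dominating {x = x} {y} (independent , maximal) Bxy lonely =
  maximal _ (insert-independent independent Bxy lonely) ⊆-insert x y (insert-self {x} {y})

row-occupied? : ∀ (M : BoxSet) y N → (∀ x → M x y ≡ true → x ≤ N) →
  Dec (∃[ x ] (M x y ≡ true))
row-occupied? M y N bounded with any? (λ (i : Fin (suc N)) → M (toℕ i) y Bool.≟ true)
... | yes (i , Miy) = yes (toℕ i , Miy)
... | no none = no λ (x , Mxy) →
  none (fromℕ< (s≤s (bounded x Mxy)) ,
        subst (λ z → M z y ≡ true) (sym (toℕ-fromℕ< (s≤s (bounded x Mxy)))) Mxy)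

module EmptyRow (D : SkewDiagram) (M : BoxSet) (maxM : IsMaximalIndependent (boxes D) M)
                (y : ℕ) (M-misses-row : ∀ x → ¬ M x y ≡ true) where

  B : BoxSet
  B = boxes D

  M⊆B : M ⊆B B
  M⊆B = proj₁ (proj₁ maxM)

  independent : ∀ i j k l → M i j ≡ true → M k l ≡ true → ¬ DowncoreEdge B i j k l
  independent = proj₂ (proj₁ maxM)

  LowerNeighbour : ℕ → Set
  LowerNeighbour x = Σ ℕ λ a → Σ ℕ λ l →
    M a l ≡ true × x < a × l < y × B x l ≡ true × B a y ≡ true

  -- If (a′ , l′) ∈ M is an upper-left neighbour of (x , y), then any
  -- lower-right neighbour (a , l) of (a′ , y) is one of (x , y) too:
  -- were a ≤ x, the row interval of l′ would make (a′ , l′), (a , l)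
  -- adjacent.
  lower-transfer : ∀ {x a′ l′} → M a′ l′ ≡ true → a′ < x → y < l′ → B x l′ ≡ true →
    LowerNeighbour a′ → LowerNeighbour x
  lower-transfer {x} {a′} {l′} Ma′l′ a′<x y<l′ Bxl′ (a , l , Mal , a′<a , l<y , Ba′l , Bay)
    with x <? a
  ... | yes x<a =
    a , l , Mal , x<a , l<y , row-convex D Ba′l (M⊆B a l Mal) (<⇒≤ a′<x) (<⇒≤ x<a) , Bay
  ... | no x≮a = ⊥-elim (independent a′ l′ a l Ma′l′ Mal
    (inj₁ (a′<a , <-trans l<y y<l′) , Ba′l , row-convex D (M⊆B a′ l′ Ma′l′) Bxl′ (<⇒≤ a′<a) (≮⇒≥ x≮a)))

  has-lower-neighbour : ∀ x → B x y ≡ true → ¬ ¬ LowerNeighbour x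
  has-lower-neighbour = <-rec _ step
    where
    step : ∀ x → (∀ {a} → a < x → B a y ≡ true → ¬ ¬ LowerNeighbour a) →
           B x y ≡ true → ¬ ¬ LowerNeighbour x
    step x ih Bxy no-lower = M-misses-row x (maximal⇒dominating maxM Bxy no-neighbour)
      where
      no-neighbour : ∀ k l → M k l ≡ true → ¬ DowncoreEdge B x y k l
      no-neighbour k l Mkl (inj₁ (x<k , l<y) , Bxl , Bky) = no-lower (k , l , Mkl , x<k , l<y , Bxl , Bky)
      no-neighbour k l Mkl (inj₂ (k<x , y<l) , Bxl , Bky) =
        ih k<x Bky (no-lower ∘ lower-transfer Mkl k<x y<l Bxl)

  row-unbounded : ∃[ x ] (B x y ≡ true) → ∀ n → ¬ ¬ (∃[ x ] (n ≤ x × B x y ≡ true))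
  row-unbounded (x , Bxy) zero = λ none → none (x , z≤n , Bxy)
  row-unbounded occupied (suc n) none = row-unbounded occupied n λ (x , n≤x , Bxy) →
    has-lower-neighbour x Bxy λ (a , _ , _ , x<a , _ , _ , Bay) →
      none (a , ≤-trans (s≤s n≤x) x<a , Bay)

  contradiction : ∃[ x ] (B x y ≡ true) → ⊥
  contradiction occupied with columns-bounded D
  ... | N , bounded = row-unbounded occupied (suc N) λ (x , N<x , Bxy) →
    <-irrefl refl (≤-trans N<x (bounded x y Bxy))

lemma3p9 : (D : SkewDiagram) (M : BoxSet) →
    IsMaximalIndependent (boxes D) M →
    (y : ℕ) → ∃[ x ] (boxes D x y ≡ true) →
    ∃[ x′ ] (M x′ y ≡ true)
lemma3p9 D M maxM y occupied with columns-bounded D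
... | N , bounded with row-occupied? M y N (λ x Mxy → bounded x y (proj₁ (proj₁ maxM) x y Mxy))
...   | yes found = found
...   | no empty = ⊥-elim (EmptyRow.contradiction D M maxM y (λ x Mxy → empty (x , Mxy)) occupied)
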